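{- There is $n_0$ such that for all $n\ge n_0$ and all integers $k$ with $\frac{n}{\log n}\le k\le \frac n2 - \frac{n}{\log n}$, writing $t_1 = t_1(n,k)$ and $s_t = s_t(n,k)$: (1) $\frac k3 \le t_1 \le \frac{11k}{12}$; (2) if $3 \le \Delta < t_1$, then for all integers $1 \le t \le t_1 - \Delta$, $\frac{s_{t+1}}{s_t} \ge 1 + \frac{\Delta}{t}$; (3) if $\log n \le \Delta < k - t_1$, then for all integers $t_1 + \Delta \le t \le k-1$, $\frac{s_{t+1}}{s_t} \le 1 - \frac{\Delta}{t}$.
   Context: $t_1(n,k) = \frac{3n - \sqrt{n^2 + 8(n-2k)^2}}{8}$. For integers $0\le t\le k$, $s_t(n,k) = \binom{n}{k}^{ -2}\binom{n}{2t}\left(\binom{2t}{t}\binom{n-2t}{k-t}\right)^2$. Logarithms are base 2.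
   Formalization: The parameter Δ in parts (2) and (3) ranges only over the rationals. -}

module Defs where

open import Data.Nat as ℕ using (ℕ; zero; suc; _∸_)
open import Data.Nat.Combinatorics using (_C_)
open import Data.Integer as ℤ using (ℤ; +_)
open import Data.Rational as ℚ using (ℚ; 0ℚ; _≟_; _÷_; ≢-nonZero; _≤_; _<_; _+_; _-_; _*_)
open import Data.Product using (_×_)
open import Data.Sum using (_⊎_)
open import Relation.Nullary using (yes; no)

-- Total division on ℚ: p /? q = p / q when q ≠ 0 (returns 0 when q = 0;
-- this case never arises in the statement's range).
_/?_ : ℚ → ℚ → ℚ
p /? q with q ≟ 0ℚ
... | yes _ = 0ℚ
... | no q≢0 = _÷_ p q {{≢-nonZero q≢0}}

ℕ→ℚ : ℕ → ℚ
ℕ→ℚ m = (+ m) ℚ./ 1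

-- s_t(n,k) = C(n,k)^{-2} C(n,2t) (C(2t,t) C(n-2t,k-t))^2
-- (used only for 0 ≤ t ≤ k ≤ n/2, where ∸ is true subtraction)
s : ℕ → ℕ → ℕ → ℚ
s n k t = ℕ→ℚ ((n C (2 ℕ.* t)) ℕ.* (((2 ℕ.* t) C t) ℕ.* ((n ∸ 2 ℕ.* t) C (k ∸ t))) ℕ.^ 2)
          /? ℕ→ℚ ((n C k) ℕ.^ 2)

-- t_1(n,k) = (3n - √D)/8 with D = n² + 8(n-2k)².  Since the standard
-- library has no reals, comparisons of a rational q with t_1 are stated
-- exactly by squaring:  q ≤ t_1 ⇔ √D ≤ 3n - 8q, etc.
D : ℕ → ℕ → ℚ
D n k = ((+ n) ℤ.* (+ n) ℤ.+ (+ 8) ℤ.* (((+ n) ℤ.- (+ (2 ℕ.* k))) ℤ.* ((+ n) ℤ.- (+ (2 ℕ.* k))))) ℚ./ 1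

-- a = 3n - 8q, so that  q ⋈ t_1  ⇔  √D ⋈ a  (with ⋈ reversed appropriately)
aT : ℕ → ℕ → ℚ → ℚ
aT n k q = ℕ→ℚ (3 ℕ.* n) - ℕ→ℚ 8 * q

-- q ≤ t_1   ⇔   √D ≤ a   ⇔   0 ≤ a ∧ D ≤ a²
_≤t₁[_,_] : ℚ → ℕ → ℕ → Set
q ≤t₁[ n , k ] = (0ℚ ≤ aT n k q) × (D n k ≤ aT n k q * aT n k q)

-- q < t_1   ⇔   √D < a   ⇔   0 ≤ a ∧ D < a²
_<t₁[_,_] : ℚ → ℕ → ℕ → Set
q <t₁[ n , k ] = (0ℚ ≤ aT n k q) × (D n k < aT n k q * aT n k q)

-- t_1 ≤ q   ⇔   a ≤ √D   ⇔   a < 0 ∨ a² ≤ D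
t₁[_,_]≤_ : ℕ → ℕ → ℚ → Set
t₁[ n , k ]≤ q = (aT n k q < 0ℚ) ⊎ (aT n k q * aT n k q ≤ D n k)

-- t_1 < q   ⇔   a < √D   ⇔   a < 0 ∨ a² < D
t₁[_,_]<_ : ℕ → ℕ → ℚ → Set
t₁[ n , k ]< q = (aT n k q < 0ℚ) ⊎ (aT n k q * aT n k q < D n k)

-- log₂ n ≤ Δ for rational Δ = p/d (d > 0) and n ≥ 1:
--   ⇔ n^d ≤ 2^p, which forces p ≥ 0.
log₂_≤_ : ℕ → ℚ → Set
log₂ n ≤ Δ = (ℤ.+ 0 ℤ.≤ ℚ.↥ Δ) × (n ℕ.^ ℚ.↧ₙ Δ ℕ.≤ 2 ℕ.^ ℤ.∣ ℚ.↥ Δ ∣)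

-- n / log₂ n ≤ k   ⇔   n ≤ k log₂ n   ⇔   2^n ≤ n^k      (n ≥ 2)
LowerK : ℕ → ℕ → Set
LowerK n k = 2 ℕ.^ n ℕ.≤ n ℕ.^ k

-- k ≤ n/2 - n/log₂ n   ⇔   2n ≤ (n - 2k) log₂ n   ⇔   2k ≤ n ∧ 2^(2n) ≤ n^(n-2k)   (n ≥ 2)
UpperK : ℕ → ℕ → Set
UpperK n k = (2 ℕ.* k ℕ.≤ n) × (2 ℕ.^ (2 ℕ.* n) ℕ.≤ n ℕ.^ (n ∸ 2 ℕ.* k))

-- Absorption identities for binomial coefficients give the ratio exactly:
--   s_{t+1}/s_t = 2(2t+1)(k-t)²(n-k-t)² / ((t+1)³(n-2t)(n-2t-1)).
-- Up to lower-order factors this is (2(k-t)(n-k-t) / (t(n-2t)))², so it exceeds 1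
-- according to the sign of  balance(x) = 2(k-x)(n-k-x) - x(n-2x).  Since
-- 16·balance(x) = (3n-8x)² - (n² + 8(n-2k)²), t₁ is the smaller root of balance, and
-- x ≤ t₁ or t₁ ≤ x is read off the sign of balance(x).  Each bound then becomes a
-- polynomial inequality, proved by writing the difference of its sides as a sum of
-- manifestly nonnegative terms.  In (2) the lower-order factors cost
-- 2(t+Δ)(t+1)³ ≤ t(2t+1)(t+2Δ)², true for t ≥ 1 and Δ ≥ 3; in (3) they are absorbed
-- by Δ(n-2k) ≥ 2n, which is what Δ ≥ log n and k ≤ n/2 - n/log n give.
module Submission where

module BinomialRatio where

  open import Data.Nat.Base
  open import Data.Nat.Properties
  open import Data.Nat.Combinatorics using (_C_; k![n∸k]!∣n!; [n-k]*d[k+1]≡[k+1]*d[k])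
  open import Data.Nat.Combinatorics.Specification using (nCk≡n!/k![n-k]!)
  open import Data.Nat.DivMod using (m/n*n≡m)
  open import Data.Nat.Tactic.RingSolver using (solve-∀)
  open import Relation.Binary.PropositionalEquality
  open ≡-Reasoning

  nCk*k!*[n∸k]!≡n! : ∀ {n k} → k ≤ n → (n C k) * (k ! * (n ∸ k) !) ≡ n !
  nCk*k!*[n∸k]!≡n! {n} {k} k≤n = trans (cong (_* (k ! * (n ∸ k) !)) (nCk≡n!/k![n-k]! k≤n))
                                       (m/n*n≡m {{k !* (n ∸ k) !≢0}} (k![n∸k]!∣n! k≤n))

  0<nCk : ∀ {n k} → k ≤ n → 0 < n C k
  0<nCk {n} {k} k≤n = n≢0⇒n>0 λ nCk≡0 →
    ≢-nonZero⁻¹ (n !) {{n !≢0}} (trans (sym (nCk*k!*[n∸k]!≡n! k≤n)) (cong (_* (k ! * (n ∸ k) !)) nCk≡0))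

  nC[1+k]*[1+k]≡nCk*[n∸k] : ∀ {n k} → k < n → (n C suc k) * suc k ≡ (n C k) * (n ∸ k)
  nC[1+k]*[1+k]≡nCk*[n∸k] {n} {k} k<n = *-cancelʳ-≡ _ _ (k ! * (n ∸ k) !) {{k !* (n ∸ k) !≢0}} (begin
    (n C suc k) * suc k * (k ! * (n ∸ k) !)             ≡⟨ *-assoc (n C suc k) (suc k) _ ⟩
    (n C suc k) * (suc k * (k ! * (n ∸ k) !))           ≡⟨ cong ((n C suc k) *_) ([n-k]*d[k+1]≡[k+1]*d[k] k<n) ⟨
    (n C suc k) * ((n ∸ k) * (suc k ! * (n ∸ suc k) !))  ≡⟨ x*[y*z]≡y*[x*z] (n C suc k) (n ∸ k) _ ⟩
    (n ∸ k) * ((n C suc k) * (suc k ! * (n ∸ suc k) !))  ≡⟨ cong ((n ∸ k) *_) (nCk*k!*[n∸k]!≡n! k<n) ⟩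
    (n ∸ k) * n !                                      ≡⟨ cong ((n ∸ k) *_) (nCk*k!*[n∸k]!≡n! (<⇒≤ k<n)) ⟨
    (n ∸ k) * ((n C k) * (k ! * (n ∸ k) !))            ≡⟨ x*[y*z]≡y*[x*z] (n ∸ k) (n C k) _ ⟩
    (n C k) * ((n ∸ k) * (k ! * (n ∸ k) !))            ≡⟨ *-assoc (n C k) (n ∸ k) _ ⟨
    (n C k) * (n ∸ k) * (k ! * (n ∸ k) !)              ∎)
    where
    x*[y*z]≡y*[x*z] : ∀ x y z → x * (y * z) ≡ y * (x * z)
    x*[y*z]≡y*[x*z] = solve-∀

  [1+n]C[1+k]*[1+k]≡[1+n]*nCk : ∀ {n k} → k ≤ n → (suc n C suc k) * suc k ≡ suc n * (n C k)
  [1+n]C[1+k]*[1+k]≡[1+n]*nCk {n} {k} k≤n = *-cancelʳ-≡ _ _ (k ! * (n ∸ k) !) {{k !* (n ∸ k) !≢0}} (begin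
    (suc n C suc k) * suc k * (k ! * (n ∸ k) !)   ≡⟨ xy*zw≡x*[yz*w] (suc n C suc k) (suc k) (k !) _ ⟩
    (suc n C suc k) * (suc k ! * (n ∸ k) !)       ≡⟨ nCk*k!*[n∸k]!≡n! (s≤s k≤n) ⟩
    suc n !                                      ≡⟨ cong (suc n *_) (nCk*k!*[n∸k]!≡n! k≤n) ⟨
    suc n * ((n C k) * (k ! * (n ∸ k) !))         ≡⟨ *-assoc (suc n) (n C k) _ ⟨
    suc n * (n C k) * (k ! * (n ∸ k) !)           ∎)
    where
    xy*zw≡x*[yz*w] : ∀ x y z w → x * y * (z * w) ≡ x * (y * z * w)
    xy*zw≡x*[yz*w] = solve-∀

  nC[2+k]*[2+k]*[1+k]≡nCk*[n∸k]*[n∸1+k] : ∀ {n k} → 2 + k ≤ n →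
    (n C (2 + k)) * ((2 + k) * (1 + k)) ≡ (n C k) * ((n ∸ k) * (n ∸ suc k))
  nC[2+k]*[2+k]*[1+k]≡nCk*[n∸k]*[n∸1+k] {n} {k} 2+k≤n = begin
    (n C (2 + k)) * ((2 + k) * (1 + k))       ≡⟨ *-assoc (n C (2 + k)) (2 + k) (1 + k) ⟨
    (n C (2 + k)) * (2 + k) * (1 + k)         ≡⟨ cong (_* (1 + k)) (nC[1+k]*[1+k]≡nCk*[n∸k] 2+k≤n) ⟩
    (n C suc k) * (n ∸ suc k) * (1 + k)       ≡⟨ x*y*z≡x*z*y (n C suc k) (n ∸ suc k) (1 + k) ⟩
    (n C suc k) * (1 + k) * (n ∸ suc k)       ≡⟨ cong (_* (n ∸ suc k)) (nC[1+k]*[1+k]≡nCk*[n∸k] (<-trans (n<1+n k) 2+k≤n)) ⟩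
    (n C k) * (n ∸ k) * (n ∸ suc k)           ≡⟨ *-assoc (n C k) (n ∸ k) (n ∸ suc k) ⟩
    (n C k) * ((n ∸ k) * (n ∸ suc k))         ∎
    where
    x*y*z≡x*z*y : ∀ x y z → x * y * z ≡ x * z * y
    x*y*z≡x*z*y = solve-∀

  [2+2t]C[1+t]*[1+t]²≡[2t]Ct*[2+2t]*[1+2t] : ∀ t →
    ((2 + 2 * t) C (1 + t)) * ((1 + t) * (1 + t)) ≡ ((2 * t) C t) * ((2 + 2 * t) * (1 + 2 * t))
  [2+2t]C[1+t]*[1+t]²≡[2t]Ct*[2+2t]*[1+2t] t = begin
    ((2 + 2 * t) C (1 + t)) * ((1 + t) * (1 + t))   ≡⟨ *-assoc ((2 + 2 * t) C (1 + t)) (1 + t) (1 + t) ⟨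
    ((2 + 2 * t) C (1 + t)) * (1 + t) * (1 + t)     ≡⟨ cong (_* (1 + t)) ([1+n]C[1+k]*[1+k]≡[1+n]*nCk t≤1+2t) ⟩
    (2 + 2 * t) * ((1 + 2 * t) C t) * (1 + t)       ≡⟨ *-assoc (2 + 2 * t) ((1 + 2 * t) C t) (1 + t) ⟩
    (2 + 2 * t) * (((1 + 2 * t) C t) * (1 + t))     ≡⟨ cong (λ m → (2 + 2 * t) * (((1 + 2 * t) C t) * m)) 1+t≡1+2t∸t ⟩
    (2 + 2 * t) * (((1 + 2 * t) C t) * (1 + 2 * t ∸ t))
      ≡⟨ cong ((2 + 2 * t) *_) (nC[1+k]*[1+k]≡nCk*[n∸k] (s≤s t≤2t)) ⟨
    (2 + 2 * t) * (((1 + 2 * t) C (1 + t)) * (1 + t)) ≡⟨ cong ((2 + 2 * t) *_) ([1+n]C[1+k]*[1+k]≡[1+n]*nCk t≤2t) ⟩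
    (2 + 2 * t) * ((1 + 2 * t) * ((2 * t) C t))       ≡⟨ x*[y*z]≡z*[x*y] (2 + 2 * t) (1 + 2 * t) ((2 * t) C t) ⟩
    ((2 * t) C t) * ((2 + 2 * t) * (1 + 2 * t))       ∎
    where
    t≤2t : t ≤ 2 * t
    t≤2t = m≤m+n t (t + 0)
    t≤1+2t : t ≤ 1 + 2 * t
    t≤1+2t = m≤n⇒m≤1+n t≤2t
    1+t≡1+2t∸t : 1 + t ≡ 1 + 2 * t ∸ t
    1+t≡1+2t∸t = sym (trans (+-∸-assoc 1 t≤2t) (cong suc (trans (cong (λ u → t + u ∸ t) (+-identityʳ t)) (m+n∸n≡m t t))))
    x*[y*z]≡z*[x*y] : ∀ x y z → x * (y * z) ≡ z * (x * y)
    x*[y*z]≡z*[x*y] = solve-∀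

  [2+m]C[1+j]*[1+j]*[1+m∸j]≡mCj*[2+m]*[1+m] : ∀ {m j} → j ≤ m →
    ((2 + m) C (1 + j)) * ((1 + j) * (1 + m ∸ j)) ≡ (m C j) * ((2 + m) * (1 + m))
  [2+m]C[1+j]*[1+j]*[1+m∸j]≡mCj*[2+m]*[1+m] {m} {j} j≤m = begin
    ((2 + m) C (1 + j)) * ((1 + j) * (1 + m ∸ j))   ≡⟨ *-assoc ((2 + m) C (1 + j)) (1 + j) (1 + m ∸ j) ⟨
    ((2 + m) C (1 + j)) * (1 + j) * (1 + m ∸ j)     ≡⟨ cong (_* (1 + m ∸ j)) ([1+n]C[1+k]*[1+k]≡[1+n]*nCk (m≤n⇒m≤1+n j≤m)) ⟩
    (2 + m) * ((1 + m) C j) * (1 + m ∸ j)           ≡⟨ *-assoc (2 + m) ((1 + m) C j) (1 + m ∸ j) ⟩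
    (2 + m) * (((1 + m) C j) * (1 + m ∸ j))         ≡⟨ cong ((2 + m) *_) (nC[1+k]*[1+k]≡nCk*[n∸k] (s≤s j≤m)) ⟨
    (2 + m) * (((1 + m) C (1 + j)) * (1 + j))       ≡⟨ cong ((2 + m) *_) ([1+n]C[1+k]*[1+k]≡[1+n]*nCk j≤m) ⟩
    (2 + m) * ((1 + m) * (m C j))                   ≡⟨ x*[y*z]≡z*[x*y] (2 + m) (1 + m) (m C j) ⟩
    (m C j) * ((2 + m) * (1 + m))                   ∎
    where
    x*[y*z]≡z*[x*y] : ∀ x y z → x * (y * z) ≡ z * (x * y)
    x*[y*z]≡z*[x*y] = solve-∀

  product-ratio : ∀ t m j l {a a′ b b′ e e′} →
    a′ * ((2 + 2 * t) * (1 + 2 * t)) ≡ a * ((2 + m) * (1 + m)) →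
    b′ * ((1 + t) * (1 + t)) ≡ b * ((2 + 2 * t) * (1 + 2 * t)) →
    e′ * ((2 + m) * (1 + m)) ≡ e * ((1 + j) * l) →
    a′ * (b′ * e′) ^ 2 * ((1 + t) * (1 + t) * (1 + t) * ((2 + m) * (1 + m)))
      ≡ a * (b * e) ^ 2 * (2 * (1 + 2 * t) * ((1 + j) * (1 + j)) * (l * l))
  product-ratio t m j l {a} {a′} {b} {b′} {e} {e′} h₁ h₂ h₃ =
    *-cancelʳ-≡ _ _ ((2 + 2 * t) * (1 + 2 * t) * (1 + t) * ((2 + m) * (1 + m))) (begin
      a′ * (b′ * e′) ^ 2 * ((1 + t) * (1 + t) * (1 + t) * ((2 + m) * (1 + m)))
         * ((2 + 2 * t) * (1 + 2 * t) * (1 + t) * ((2 + m) * (1 + m)))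
        ≡⟨ lhs-shape t m a′ b′ e′ ⟩
      (a′ * ((2 + 2 * t) * (1 + 2 * t)))
         * (((b′ * ((1 + t) * (1 + t))) * (e′ * ((2 + m) * (1 + m))))
           * ((b′ * ((1 + t) * (1 + t))) * (e′ * ((2 + m) * (1 + m)))))
        ≡⟨ cong₂ (λ x y → x * (y * y)) h₁ (cong₂ _*_ h₂ h₃) ⟩
      (a * ((2 + m) * (1 + m)))
         * (((b * ((2 + 2 * t) * (1 + 2 * t))) * (e * ((1 + j) * l)))
           * ((b * ((2 + 2 * t) * (1 + 2 * t))) * (e * ((1 + j) * l))))
        ≡⟨ rhs-shape t m j l a b e ⟩
      a * (b * e) ^ 2 * (2 * (1 + 2 * t) * ((1 + j) * (1 + j)) * (l * l))
         * ((2 + 2 * t) * (1 + 2 * t) * (1 + t) * ((2 + m) * (1 + m))) ∎)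
    where
    -- x ^ 2 appears as its unfolding x * (x * 1), which the solver can read.
    lhs-shape : ∀ t m a′ b′ e′ →
      a′ * ((b′ * e′) * ((b′ * e′) * 1)) * ((1 + t) * (1 + t) * (1 + t) * ((2 + m) * (1 + m)))
         * ((2 + 2 * t) * (1 + 2 * t) * (1 + t) * ((2 + m) * (1 + m)))
      ≡ (a′ * ((2 + 2 * t) * (1 + 2 * t)))
         * (((b′ * ((1 + t) * (1 + t))) * (e′ * ((2 + m) * (1 + m))))
           * ((b′ * ((1 + t) * (1 + t))) * (e′ * ((2 + m) * (1 + m)))))
    lhs-shape = solve-∀
    rhs-shape : ∀ t m j l a b e →
      (a * ((2 + m) * (1 + m)))
         * (((b * ((2 + 2 * t) * (1 + 2 * t))) * (e * ((1 + j) * l)))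
           * ((b * ((2 + 2 * t) * (1 + 2 * t))) * (e * ((1 + j) * l))))
      ≡ a * ((b * e) * ((b * e) * 1)) * (2 * (1 + 2 * t) * ((1 + j) * (1 + j)) * (l * l))
         * ((2 + 2 * t) * (1 + 2 * t) * (1 + t) * ((2 + m) * (1 + m)))
    rhs-shape = solve-∀

  s-numerator : ℕ → ℕ → ℕ → ℕ
  s-numerator n k t = (n C (2 * t)) * (((2 * t) C t) * ((n ∸ 2 * t) C (k ∸ t))) ^ 2

  k∸t≤n∸2t : ∀ {n k} t → 2 * k ≤ n → k ∸ t ≤ n ∸ 2 * t
  k∸t≤n∸2t {n} {k} t 2k≤n = ≤-trans (m≤m+n (k ∸ t) (k ∸ t + 0))
    (subst (_≤ n ∸ 2 * t) (sym (*-distribˡ-∸ 2 k t)) (∸-monoˡ-≤ (2 * t) 2k≤n))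

  0<s-numerator : ∀ {n k t} → t ≤ k → 2 * k ≤ n → 0 < s-numerator n k t
  0<s-numerator {n} {k} {t} t≤k 2k≤n =
    *-mono-< (0<nCk (≤-trans (*-monoʳ-≤ 2 t≤k) 2k≤n))
             (m^n>0 _ {{>-nonZero (*-mono-< (0<nCk (m≤m+n t (t + 0))) (0<nCk (k∸t≤n∸2t t 2k≤n)))}} 2)

  s-numerator-ratio : ∀ {n k t} → suc t ≤ k → 2 * k ≤ n →
    s-numerator n k (suc t) * ((1 + t) * (1 + t) * (1 + t) * ((n ∸ 2 * t) * (n ∸ suc (2 * t))))
      ≡ s-numerator n k t * (2 * (1 + 2 * t) * ((k ∸ t) * (k ∸ t)) * ((n ∸ 2 * t ∸ (k ∸ t)) * (n ∸ 2 * t ∸ (k ∸ t))))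
  s-numerator-ratio {n} {k} {t} t<k 2k≤n = begin
    s-numerator n k (suc t) * ((1 + t) * (1 + t) * (1 + t) * ((n ∸ 2 * t) * (n ∸ suc (2 * t))))
      ≡⟨ cong₂ (λ u v → s-numerator n k (suc t) * ((1 + t) * (1 + t) * (1 + t) * (u * v))) n∸2t≡2+m n∸1+2t≡1+m ⟩
    s-numerator n k (suc t) * ((1 + t) * (1 + t) * (1 + t) * ((2 + m) * (1 + m)))
      ≡⟨ cong (λ u → (n C u) * ((u C suc t) * ((n ∸ u) C j)) ^ 2 * ((1 + t) * (1 + t) * (1 + t) * ((2 + m) * (1 + m))))
              (*-suc 2 t) ⟩
    (n C (2 + 2 * t)) * (((2 + 2 * t) C (1 + t)) * (m C j)) ^ 2 * ((1 + t) * (1 + t) * (1 + t) * ((2 + m) * (1 + m)))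
      ≡⟨ product-ratio t m j (1 + m ∸ j) {n C (2 * t)} {n C (2 + 2 * t)} {(2 * t) C t} {(2 + 2 * t) C (1 + t)}
                       {(2 + m) C (1 + j)} {m C j}
                       h₁ ([2+2t]C[1+t]*[1+t]²≡[2t]Ct*[2+2t]*[1+2t] t)
                       (sym ([2+m]C[1+j]*[1+j]*[1+m∸j]≡mCj*[2+m]*[1+m] j≤m)) ⟩
    (n C (2 * t)) * (((2 * t) C t) * ((2 + m) C (1 + j))) ^ 2
      * (2 * (1 + 2 * t) * ((1 + j) * (1 + j)) * ((1 + m ∸ j) * (1 + m ∸ j)))
      ≡⟨ cong₂ (λ u v → (n C (2 * t)) * (((2 * t) C t) * (u C v)) ^ 2 * (2 * (1 + 2 * t) * (v * v) * ((u ∸ v) * (u ∸ v))))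
               n∸2t≡2+m k∸t≡1+j ⟨
    s-numerator n k t * (2 * (1 + 2 * t) * ((k ∸ t) * (k ∸ t)) * ((n ∸ 2 * t ∸ (k ∸ t)) * (n ∸ 2 * t ∸ (k ∸ t)))) ∎
    where
    m j : ℕ
    m = n ∸ (2 + 2 * t)
    j = k ∸ suc t
    2+2t≤n : 2 + 2 * t ≤ n
    2+2t≤n = subst (_≤ n) (*-suc 2 t) (≤-trans (*-monoʳ-≤ 2 t<k) 2k≤n)
    n∸1+2t≡1+m : n ∸ suc (2 * t) ≡ 1 + m
    n∸1+2t≡1+m = +-∸-assoc 1 2+2t≤n
    n∸2t≡2+m : n ∸ 2 * t ≡ 2 + m
    n∸2t≡2+m = trans (+-∸-assoc 1 (≤-trans (n≤1+n _) 2+2t≤n)) (cong suc n∸1+2t≡1+m)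
    k∸t≡1+j : k ∸ t ≡ 1 + j
    k∸t≡1+j = +-∸-assoc 1 t<k
    j≤m : j ≤ m
    j≤m = subst (λ u → j ≤ n ∸ u) (*-suc 2 t) (k∸t≤n∸2t {n} {k} (suc t) 2k≤n)
    h₁ : (n C (2 + 2 * t)) * ((2 + 2 * t) * (1 + 2 * t)) ≡ (n C (2 * t)) * ((2 + m) * (1 + m))
    h₁ = trans (nC[2+k]*[2+k]*[1+k]≡nCk*[n∸k]*[n∸1+k] 2+2t≤n)
               (cong₂ (λ u v → (n C (2 * t)) * (u * v)) n∸2t≡2+m n∸1+2t≡1+m)

open import Defs
open import Data.Nat as ℕ using (ℕ; zero; suc; z≤n; s≤s)
import Data.Nat.Properties as ℕP
import Data.Nat.Literals as ℕ
open import Data.Nat.Combinatorics using (_C_)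
open import Data.Integer as ℤ using (ℤ; +_)
import Data.Integer.Properties as ℤP
open import Data.Rational as ℚ using (ℚ; 0ℚ; 1ℚ; _≤_; _<_; _+_; _-_; _*_)
open import Data.Rational.Literals as ℚ using (fromℤ)
import Data.Rational.Properties as ℚP
import Data.Rational.Unnormalised as ℚᵘ
import Data.Rational.Unnormalised.Properties as ℚᵘP
open import Data.Product using (Σ; _×_; _,_; proj₁; proj₂; uncurry)
open import Data.Sum using (inj₁; inj₂)
open import Data.Empty using (⊥-elim)
open import Data.Unit.Base using (⊤; tt)
open import Data.List.Base using (_∷_; [])
open import Level using (0ℓ)
open import Relation.Nullary using (¬_; yes; no)
open import Relation.Nullary.Decidable.Core using (dec⇒maybe)
open import Relation.Binary.PropositionalEquality
open import Tactic.RingSolver using (solve)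
import Tactic.RingSolver.Core.AlmostCommutativeRing as ACR
open import Agda.Builtin.FromNat using (Number; fromNat)

open BinomialRatio using (s-numerator; s-numerator-ratio; 0<s-numerator; 0<nCk; k∸t≤n∸2t)

-- From here on numerals are overloaded.  A rational numeral m is definitionally ℕ→ℚ m, so
-- the statement's ℕ→ℚ 3, ℕ→ℚ 12, … and the numerals below match by conversion.
instance
  ℕ-number : Number ℕ
  ℕ-number = ℕ.number
  ℚ-number : Number ℚ
  ℚ-number = ℚ.number
  ⊤-instance : ⊤
  ⊤-instance = tt

ℚ-ring : ACR.AlmostCommutativeRing 0ℓ 0ℓ
ℚ-ring = ACR.fromCommutativeRing ℚP.+-*-commutativeRing (λ x → dec⇒maybe (0ℚ ℚP.≟ x))

ℤ→ℚ : ℤ → ℚ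
ℤ→ℚ i = i ℚ./ 1

-- Unlike i / 1, fromℤ i is already normalised, so sums and products of such terms compute.
ℤ→ℚ≡fromℤ : ∀ i → ℤ→ℚ i ≡ fromℤ i
ℤ→ℚ≡fromℤ i = ℚP.fromℚᵘ-toℚᵘ (fromℤ i)

ℤ→ℚ-+ : ∀ i j → ℤ→ℚ (i ℤ.+ j) ≡ ℤ→ℚ i + ℤ→ℚ j
ℤ→ℚ-+ i j = begin
  (i ℤ.+ j) ℚ./ 1                    ≡⟨ cong (ℚ._/ 1) (cong₂ ℤ._+_ (ℤP.*-identityʳ i) (ℤP.*-identityʳ j)) ⟨
  (i ℤ.* + 1 ℤ.+ j ℤ.* + 1) ℚ./ 1    ≡⟨⟩
  fromℤ i + fromℤ j                   ≡⟨ cong₂ _+_ (ℤ→ℚ≡fromℤ i) (ℤ→ℚ≡fromℤ j) ⟨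
  ℤ→ℚ i + ℤ→ℚ j                       ∎
  where open ≡-Reasoning

ℤ→ℚ-* : ∀ i j → ℤ→ℚ (i ℤ.* j) ≡ ℤ→ℚ i * ℤ→ℚ j
ℤ→ℚ-* i j = sym (cong₂ _*_ (ℤ→ℚ≡fromℤ i) (ℤ→ℚ≡fromℤ j))

fromℤ-neg : ∀ i → fromℤ (ℤ.- i) ≡ ℚ.- fromℤ i
fromℤ-neg (+ zero)   = refl
fromℤ-neg ℤ.+[1+ _ ] = refl
fromℤ-neg ℤ.-[1+ _ ] = refl

ℤ→ℚ-- : ∀ i j → ℤ→ℚ (i ℤ.- j) ≡ ℤ→ℚ i - ℤ→ℚ j
ℤ→ℚ-- i j = trans (ℤ→ℚ-+ i (ℤ.- j)) (cong (_+_ (ℤ→ℚ i)) (begin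
  ℤ→ℚ (ℤ.- j)      ≡⟨ ℤ→ℚ≡fromℤ (ℤ.- j) ⟩
  fromℤ (ℤ.- j)     ≡⟨ fromℤ-neg j ⟩
  ℚ.- fromℤ j       ≡⟨ cong ℚ.-_ (ℤ→ℚ≡fromℤ j) ⟨
  ℚ.- ℤ→ℚ j        ∎))
  where open ≡-Reasoning

ℤ→ℚ-mono-≤ : ∀ {i j} → i ℤ.≤ j → ℤ→ℚ i ≤ ℤ→ℚ j
ℤ→ℚ-mono-≤ {i} {j} i≤j = subst₂ _≤_ (sym (ℤ→ℚ≡fromℤ i)) (sym (ℤ→ℚ≡fromℤ j))
                                  (ℚ.*≤* (ℤP.*-monoʳ-≤-nonNeg (+ 1) i≤j))

ℤ→ℚ-mono-< : ∀ {i j} → i ℤ.< j → ℤ→ℚ i < ℤ→ℚ j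
ℤ→ℚ-mono-< {i} {j} i<j = subst₂ _<_ (sym (ℤ→ℚ≡fromℤ i)) (sym (ℤ→ℚ≡fromℤ j))
                                  (ℚ.*<* (ℤP.*-monoʳ-<-pos (+ 1) i<j))

ℕ→ℚ-+ : ∀ a b → ℕ→ℚ (a ℕ.+ b) ≡ ℕ→ℚ a + ℕ→ℚ b
ℕ→ℚ-+ a b = trans (cong ℤ→ℚ (ℤP.pos-+ a b)) (ℤ→ℚ-+ (+ a) (+ b))

ℕ→ℚ-* : ∀ a b → ℕ→ℚ (a ℕ.* b) ≡ ℕ→ℚ a * ℕ→ℚ b
ℕ→ℚ-* a b = trans (cong ℤ→ℚ (ℤP.pos-* a b)) (ℤ→ℚ-* (+ a) (+ b))

ℕ→ℚ-*₂ : ∀ a b {x y} → ℕ→ℚ a ≡ x → ℕ→ℚ b ≡ y → ℕ→ℚ (a ℕ.* b) ≡ x * y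
ℕ→ℚ-*₂ a b a≡x b≡y = trans (ℕ→ℚ-* a b) (cong₂ _*_ a≡x b≡y)

ℕ→ℚ-∸ : ∀ {a b} → b ℕ.≤ a → ℕ→ℚ (a ℕ.∸ b) ≡ ℕ→ℚ a - ℕ→ℚ b
ℕ→ℚ-∸ {a} {b} b≤a = trans (cong ℤ→ℚ (trans (sym (ℤP.⊖-≥ b≤a)) (sym (ℤP.m-n≡m⊖n a b)))) (ℤ→ℚ-- (+ a) (+ b))

ℕ→ℚ-suc : ∀ a → ℕ→ℚ (suc a) ≡ ℕ→ℚ a + 1
ℕ→ℚ-suc a = trans (cong ℕ→ℚ (ℕP.+-comm 1 a)) (ℕ→ℚ-+ a 1)

ℕ→ℚ-mono-≤ : ∀ {a b} → a ℕ.≤ b → ℕ→ℚ a ≤ ℕ→ℚ b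
ℕ→ℚ-mono-≤ a≤b = ℤ→ℚ-mono-≤ (ℤ.+≤+ a≤b)

ℕ→ℚ-mono-< : ∀ {a b} → a ℕ.< b → ℕ→ℚ a < ℕ→ℚ b
ℕ→ℚ-mono-< a<b = ℤ→ℚ-mono-< (ℤ.+<+ a<b)

ℕ→ℚ-cancel-< : ∀ {a b} → ℕ→ℚ a < ℕ→ℚ b → a ℕ.< b
ℕ→ℚ-cancel-< a<b = ℕP.≰⇒> (λ b≤a → ℚP.<-irrefl refl (ℚP.<-≤-trans a<b (ℕ→ℚ-mono-≤ b≤a)))

0≤ℕ : ∀ n → 0 ≤ ℕ→ℚ n
0≤ℕ n = ℕ→ℚ-mono-≤ {0} {n} z≤n

0<ℕ : ∀ n .{{_ : ℕ.NonZero n}} → 0 < ℕ→ℚ n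
0<ℕ n = ℕ→ℚ-mono-< {0} {n} (ℕ.>-nonZero⁻¹ n)

2k≤n⇒2K≤N : ∀ n k → 2 ℕ.* k ℕ.≤ n → 2 * ℕ→ℚ k ≤ ℕ→ℚ n
2k≤n⇒2K≤N n k 2k≤n = subst (_≤ ℕ→ℚ n) (ℕ→ℚ-* 2 k) (ℕ→ℚ-mono-≤ 2k≤n)

infixl 6 _⊕_ _⊕⁺_
infixl 7 _⊗_ _⊗⁺_

_⊕_ : ∀ {p q} → 0 ≤ p → 0 ≤ q → 0 ≤ p + q
0≤p ⊕ 0≤q = ℚP.+-mono-≤ 0≤p 0≤q

_⊕⁺_ : ∀ {p q} → 0 < p → 0 ≤ q → 0 < p + q
0<p ⊕⁺ 0≤q = ℚP.+-mono-<-≤ 0<p 0≤q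

_⊗_ : ∀ {p q} → 0 ≤ p → 0 ≤ q → 0 ≤ p * q
_⊗_ {p} {q} 0≤p 0≤q = ℚP.nonNegative⁻¹ _
  {{ℚP.nonNeg*nonNeg⇒nonNeg p {{ℚ.nonNegative 0≤p}} q {{ℚ.nonNegative 0≤q}}}}

_⊗⁺_ : ∀ {p q} → 0 < p → 0 < q → 0 < p * q
_⊗⁺_ {p} {q} 0<p 0<q = ℚP.positive⁻¹ _ {{ℚP.pos*pos⇒pos p {{ℚ.positive 0<p}} q {{ℚ.positive 0<q}}}}

0≤p*p : ∀ p → 0 ≤ p * p
0≤p*p p with ℚP.≤-total 0 p
... | inj₁ 0≤p = 0≤p ⊗ 0≤p
... | inj₂ p≤0 = subst (0 ≤_) (-p*-p≡p*p p) (0≤-p ⊗ 0≤-p)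
  where
  0≤-p : 0 ≤ ℚ.- p
  0≤-p = ℚP.neg-antimono-≤ p≤0
  -p*-p≡p*p : ∀ p → ℚ.- p * ℚ.- p ≡ p * p
  -p*-p≡p*p p = solve (p ∷ []) ℚ-ring

0≤-by : ∀ {x e} → x ≡ e → 0 ≤ e → 0 ≤ x
0≤-by x≡e = subst (0 ≤_) (sym x≡e)

0<-by : ∀ {x e} → x ≡ e → 0 < e → 0 < x
0<-by x≡e = subst (0 <_) (sym x≡e)

p+[q-p]≡q : ∀ p q → p + (q - p) ≡ q
p+[q-p]≡q p q = solve (p ∷ q ∷ []) ℚ-ring

≤-by : ∀ {p q e} → q - p ≡ e → 0 ≤ e → p ≤ q
≤-by {p} {q} q-p≡e 0≤e =
  subst₂ _≤_ (ℚP.+-identityʳ p) (p+[q-p]≡q p q) (ℚP.+-monoʳ-≤ p (0≤-by q-p≡e 0≤e))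

<-by : ∀ {p q e} → q - p ≡ e → 0 < e → p < q
<-by {p} {q} q-p≡e 0<e =
  subst₂ _<_ (ℚP.+-identityʳ p) (p+[q-p]≡q p q) (ℚP.+-monoʳ-< p (0<-by q-p≡e 0<e))

≤-by-multiple : ∀ {c p q e} → 0 < c → c * (q - p) ≡ e → 0 ≤ e → p ≤ q
≤-by-multiple {c} {p} {q} 0<c c[q-p]≡e 0≤e = ≤-by refl
  (ℚP.*-cancelˡ-≤-pos c {{ℚ.positive 0<c}} (subst (_≤ c * (q - p)) (sym (ℚP.*-zeroʳ c)) (0≤-by c[q-p]≡e 0≤e)))

0≤-by-multiple : ∀ {c x e} → 0 < c → c * x ≡ e → 0 ≤ e → 0 ≤ x
0≤-by-multiple {c} {x} 0<c cx≡e 0≤e =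
  ℚP.*-cancelˡ-≤-pos c {{ℚ.positive 0<c}} (subst (_≤ c * x) (sym (ℚP.*-zeroʳ c)) (0≤-by cx≡e 0≤e))

0<x*c⇒0<x : ∀ {x c} → 0 ≤ c → 0 < x * c → 0 < x
0<x*c⇒0<x {x} {c} 0≤c 0<xc =
  ℚP.*-cancelʳ-<-nonNeg c {{ℚ.nonNegative 0≤c}} (subst (_< x * c) (sym (ℚP.*-zeroˡ c)) 0<xc)

p≤q⇒0≤q-p : ∀ {p q} → p ≤ q → 0 ≤ q - p
p≤q⇒0≤q-p {p} {q} p≤q = subst (_≤ q - p) (ℚP.+-inverseʳ p) (ℚP.+-monoˡ-≤ (ℚ.- p) p≤q)

p<q⇒0<q-p : ∀ {p q} → p < q → 0 < q - p
p<q⇒0<q-p {p} {q} p<q = subst (_< q - p) (ℚP.+-inverseʳ p) (ℚP.+-monoˡ-< (ℚ.- p) p<q)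

p≤q⇒p*p≤q*q : ∀ {p q} → 0 ≤ p → p ≤ q → p * p ≤ q * q
p≤q⇒p*p≤q*q {p} {q} 0≤p p≤q = ℚP.≤-trans (ℚP.*-monoˡ-≤-nonNeg p {{ℚ.nonNegative 0≤p}} p≤q)
                                         (ℚP.*-monoʳ-≤-nonNeg q {{ℚ.nonNegative (ℚP.≤-trans 0≤p p≤q)}} p≤q)

p*p≤q*q⇒p≤q : ∀ {p q} → 0 ≤ q → p * p ≤ q * q → p ≤ q
p*p≤q*q⇒p≤q {p} {q} 0≤q p*p≤q*q with p ℚP.≤? q
... | yes p≤q = p≤q
... | no p≰q = ⊥-elim (ℚP.<-irrefl refl (ℚP.≤-<-trans p*p≤q*q q*q<p*p))
  where
  q<p : q < p
  q<p = ℚP.≰⇒> p≰q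
  q*q<p*p : q * q < p * p
  q*q<p*p = ℚP.≤-<-trans (ℚP.*-monoˡ-≤-nonNeg q {{ℚ.nonNegative 0≤q}} (ℚP.<⇒≤ q<p))
                         (ℚP.*-monoˡ-<-pos p {{ℚ.positive (ℚP.≤-<-trans 0≤q q<p)}} q<p)

*-cancelˡ-≡-pos : ∀ {c p q} → 0 < c → c * p ≡ c * q → p ≡ q
*-cancelˡ-≡-pos {c} 0<c cp≡cq = ℚP.≤-antisym (cancel (ℚP.≤-reflexive cp≡cq)) (cancel (ℚP.≤-reflexive (sym cp≡cq)))
  where
  cancel : ∀ {p q} → c * p ≤ c * q → p ≤ q
  cancel = ℚP.*-cancelˡ-≤-pos c {{ℚ.positive 0<c}}

p/?q*q≡p : ∀ p {q} → ¬ q ≡ 0 → (p /? q) * q ≡ p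
p/?q*q≡p p {q} q≢0 with q ℚP.≟ 0ℚ
... | yes q≡0 = ⊥-elim (q≢0 q≡0)
... | no q≢0′ = begin
  p * ℚ.1/ q * q     ≡⟨ ℚP.*-assoc p (ℚ.1/ q) q ⟩
  p * (ℚ.1/ q * q)   ≡⟨ cong (p *_) (ℚP.*-inverseˡ q) ⟩
  p * 1ℚ             ≡⟨ ℚP.*-identityʳ p ⟩
  p                  ∎
  where
  open ≡-Reasoning
  instance
    q≢0-instance : ℚ.NonZero q
    q≢0-instance = ℚ.≢-nonZero q≢0′

0<q⇒q≢0 : ∀ {q} → 0 < q → ¬ q ≡ 0
0<q⇒q≢0 0<q q≡0 = ℚP.<-irrefl (sym q≡0) 0<q

balance : ℚ → ℚ → ℚ → ℚ
balance N K X = 2 * (K - X) * (N - K - X) - X * (N - 2 * X)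

aT≡ : ∀ n k X → aT n k X ≡ 3 * ℕ→ℚ n - 8 * X
aT≡ n k X = cong (_- 8 * X) (ℕ→ℚ-* 3 n)

D≡ : ∀ n k → D n k ≡ ℕ→ℚ n * ℕ→ℚ n + 8 * ((ℕ→ℚ n - 2 * ℕ→ℚ k) * (ℕ→ℚ n - 2 * ℕ→ℚ k))
D≡ n k = begin
  ℤ→ℚ (+ n ℤ.* + n ℤ.+ + 8 ℤ.* (z ℤ.* z))          ≡⟨ ℤ→ℚ-+ (+ n ℤ.* + n) (+ 8 ℤ.* (z ℤ.* z)) ⟩
  ℤ→ℚ (+ n ℤ.* + n) + ℤ→ℚ (+ 8 ℤ.* (z ℤ.* z))
    ≡⟨ cong₂ _+_ (ℤ→ℚ-* (+ n) (+ n)) (trans (ℤ→ℚ-* (+ 8) (z ℤ.* z)) (cong (8 *_) (ℤ→ℚ-* z z))) ⟩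
  ℕ→ℚ n * ℕ→ℚ n + 8 * (ℤ→ℚ z * ℤ→ℚ z)            ≡⟨ cong (λ x → ℕ→ℚ n * ℕ→ℚ n + 8 * (x * x)) n-2k ⟩
  ℕ→ℚ n * ℕ→ℚ n + 8 * ((ℕ→ℚ n - 2 * ℕ→ℚ k) * (ℕ→ℚ n - 2 * ℕ→ℚ k)) ∎
  where
  open ≡-Reasoning
  z : ℤ
  z = + n ℤ.- + (2 ℕ.* k)
  n-2k : ℤ→ℚ z ≡ ℕ→ℚ n - 2 * ℕ→ℚ k
  n-2k = trans (ℤ→ℚ-- (+ n) (+ (2 ℕ.* k))) (cong (ℕ→ℚ n -_) (ℕ→ℚ-* 2 k))

aT²-D≡16·balance : ∀ n k X → aT n k X * aT n k X - D n k ≡ 16 * balance (ℕ→ℚ n) (ℕ→ℚ k) X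
aT²-D≡16·balance n k X = trans (cong₂ (λ a d → a * a - d) (aT≡ n k X) (D≡ n k)) (expand (ℕ→ℚ n) (ℕ→ℚ k) X)
  where
  expand : ∀ N K X → (3 * N - 8 * X) * (3 * N - 8 * X) - (N * N + 8 * ((N - 2 * K) * (N - 2 * K)))
                     ≡ 16 * (2 * (K - X) * (N - K - X) - X * (N - 2 * X))
  expand N K X = solve (N ∷ K ∷ X ∷ []) ℚ-ring

≤t₁⇒0≤balance : ∀ n k X → X ≤t₁[ n , k ] → 0 ≤ balance (ℕ→ℚ n) (ℕ→ℚ k) X
≤t₁⇒0≤balance n k X (_ , D≤a²) = 0≤-by-multiple (0<ℕ 16) (sym (aT²-D≡16·balance n k X)) (p≤q⇒0≤q-p D≤a²)

≤t₁⇒4X≤N : ∀ n k X → X ≤t₁[ n , k ] → 4 * X ≤ ℕ→ℚ n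
≤t₁⇒4X≤N n k X (0≤a , D≤a²) = ≤-by-multiple (0<ℕ 2) (a-N n k X) (p≤q⇒0≤q-p N≤a)
  where
  N*N≤D : ℕ→ℚ n * ℕ→ℚ n ≤ D n k
  N*N≤D = ≤-by (trans (cong (_- ℕ→ℚ n * ℕ→ℚ n) (D≡ n k)) (D-N² (ℕ→ℚ n) (ℕ→ℚ k)))
                (0≤ℕ 8 ⊗ 0≤p*p (ℕ→ℚ n - 2 * ℕ→ℚ k))
    where
    D-N² : ∀ N K → N * N + 8 * ((N - 2 * K) * (N - 2 * K)) - N * N ≡ 8 * ((N - 2 * K) * (N - 2 * K))
    D-N² N K = solve (N ∷ K ∷ []) ℚ-ring
  N≤a : ℕ→ℚ n ≤ aT n k X
  N≤a = p*p≤q*q⇒p≤q 0≤a (ℚP.≤-trans N*N≤D D≤a²)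
  a-N : ∀ n k X → 2 * (ℕ→ℚ n - 4 * X) ≡ aT n k X - ℕ→ℚ n
  a-N n k X = trans (expand (ℕ→ℚ n) X) (cong (_- ℕ→ℚ n) (sym (aT≡ n k X)))
    where
    expand : ∀ N X → 2 * (N - 4 * X) ≡ 3 * N - 8 * X - N
    expand N X = solve (N ∷ X ∷ []) ℚ-ring

0≤balance⇒≤t₁ : ∀ n k X → 4 * X ≤ ℕ→ℚ n → 0 ≤ balance (ℕ→ℚ n) (ℕ→ℚ k) X → X ≤t₁[ n , k ]
0≤balance⇒≤t₁ n k X 4X≤N 0≤balance =
  0≤-by (trans (aT≡ n k X) (expand (ℕ→ℚ n) X)) (0≤ℕ n ⊕ 0≤ℕ 2 ⊗ p≤q⇒0≤q-p 4X≤N) ,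
  ≤-by (aT²-D≡16·balance n k X) (0≤ℕ 16 ⊗ 0≤balance)
  where
  expand : ∀ N X → 3 * N - 8 * X ≡ N + 2 * (N - 4 * X)
  expand N X = solve (N ∷ X ∷ []) ℚ-ring

D-aT²≡16·[0-balance] : ∀ n k X → D n k - aT n k X * aT n k X ≡ 16 * (0 - balance (ℕ→ℚ n) (ℕ→ℚ k) X)
D-aT²≡16·[0-balance] n k X = begin
  D n k - aT n k X * aT n k X                    ≡⟨ x-y≡0-[y-x] (D n k) (aT n k X * aT n k X) ⟩
  0 - (aT n k X * aT n k X - D n k)              ≡⟨ cong (0 -_) (aT²-D≡16·balance n k X) ⟩
  0 - 16 * balance (ℕ→ℚ n) (ℕ→ℚ k) X          ≡⟨ 0-16x≡16[0-x] (balance (ℕ→ℚ n) (ℕ→ℚ k) X) ⟩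
  16 * (0 - balance (ℕ→ℚ n) (ℕ→ℚ k) X)        ∎
  where
  open ≡-Reasoning
  x-y≡0-[y-x] : ∀ x y → x - y ≡ 0 - (y - x)
  x-y≡0-[y-x] x y = solve (x ∷ y ∷ []) ℚ-ring
  0-16x≡16[0-x] : ∀ x → 0 - 16 * x ≡ 16 * (0 - x)
  0-16x≡16[0-x] x = solve (x ∷ []) ℚ-ring

balance≤0⇒t₁≤ : ∀ n k X → balance (ℕ→ℚ n) (ℕ→ℚ k) X ≤ 0 → t₁[ n , k ]≤ X
balance≤0⇒t₁≤ n k X balance≤0 = inj₂ (≤-by (D-aT²≡16·[0-balance] n k X) (0≤ℕ 16 ⊗ p≤q⇒0≤q-p balance≤0))

-- The larger root of balance is at least n/2, hence the hypothesis 2X ≤ n.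
t₁≤⇒balance≤0 : ∀ n k X → 2 * X ≤ ℕ→ℚ n → t₁[ n , k ]≤ X → balance (ℕ→ℚ n) (ℕ→ℚ k) X ≤ 0
t₁≤⇒balance≤0 n k X _ (inj₂ a²≤D) =
  ≤-by-multiple (0<ℕ 16) (sym (D-aT²≡16·[0-balance] n k X)) (p≤q⇒0≤q-p a²≤D)
t₁≤⇒balance≤0 n k X 2X≤N (inj₁ a<0) = ≤-by-multiple (0<ℕ 16) certificate
  (p≤q⇒0≤q-p (ℚP.<⇒≤ a<0) ⊗ (0≤ℕ 4 ⊗ p≤q⇒0≤q-p 2X≤N) ⊕ 0≤ℕ 4 ⊗ 0≤ℕ n ⊗ p≤q⇒0≤q-p 2X≤N
   ⊕ 0≤ℕ 8 ⊗ 0≤p*p (N - 2 * K))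
  where
  N K : ℚ
  N = ℕ→ℚ n
  K = ℕ→ℚ k
  certificate : 16 * (0 - balance N K X)
                ≡ (0 - aT n k X) * (4 * (N - 2 * X)) + 4 * N * (N - 2 * X) + 8 * ((N - 2 * K) * (N - 2 * K))
  certificate = trans (expand N K X) (cong (λ a → (0 - a) * (4 * (N - 2 * X)) + 4 * N * (N - 2 * X) + 8 * ((N - 2 * K) * (N - 2 * K)))
                                           (sym (aT≡ n k X)))
    where
    expand : ∀ N K X → 16 * (0 - (2 * (K - X) * (N - K - X) - X * (N - 2 * X)))
             ≡ (0 - (3 * N - 8 * X)) * (4 * (N - 2 * X)) + 4 * N * (N - 2 * X) + 8 * ((N - 2 * K) * (N - 2 * K))
    expand N K X = solve (N ∷ K ∷ X ∷ []) ℚ-ring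

0≤balance⇒<K : ∀ {N K X} → 0 < K → 2 * K < N → 4 * X ≤ N → 0 ≤ balance N K X → X < K
0≤balance⇒<K {N} {K} {X} 0<K 2K<N 4X≤N 0≤balance =
  <-by refl (0<x*c⇒0<x (p≤q⇒0≤q-p 4X≤N ⊕ 0≤ℕ 2 ⊗ ℚP.<⇒≤ (p<q⇒0<q-p 2K<N))
                       (0<-by (certificate N K X) (0<K ⊗⁺ p<q⇒0<q-p 2K<N ⊕⁺ 0≤balance)))
  where
  certificate : ∀ N K X → (K - X) * ((N - 4 * X) + 2 * (N - 2 * K))
                        ≡ K * (N - 2 * K) + (2 * (K - X) * (N - K - X) - X * (N - 2 * X))
  certificate N K X = solve (N ∷ K ∷ X ∷ []) ℚ-ring

balance≤0⇒0<X : ∀ {N K X} → 0 < K → 2 * K ≤ N → balance N K X ≤ 0 → 0 < X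
balance≤0⇒0<X {N} {K} {X} 0<K 2K≤N balance≤0 =
  0<x*c⇒0<x (0≤ℕ 3 ⊗ ℚP.≤-trans (0≤ℕ 2 ⊗ ℚP.<⇒≤ 0<K) 2K≤N)
    (0<-by (certificate N K X)
      (0<ℕ 2 ⊗⁺ 0<K ⊗⁺ (0<K ⊕⁺ p≤q⇒0≤q-p 2K≤N) ⊕⁺ 0≤ℕ 4 ⊗ 0≤p*p X ⊕⁺ p≤q⇒0≤q-p balance≤0))
  where
  certificate : ∀ N K X → X * (3 * N)
    ≡ 2 * K * (K + (N - 2 * K)) + 4 * (X * X) + (0 - (2 * (K - X) * (N - K - X) - X * (N - 2 * X)))
  certificate N K X = solve (N ∷ K ∷ X ∷ []) ℚ-ring

2[T+Δ][T+1]³≤T[1+2T][T+2Δ]² : ∀ {T Δ} → 1 ≤ T → 3 ≤ Δ →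
  2 * (T + Δ) * ((T + 1) * (T + 1) * (T + 1)) ≤ T * (1 + 2 * T) * ((T + 2 * Δ) * (T + 2 * Δ))
2[T+Δ][T+1]³≤T[1+2T][T+2Δ]² {T} {Δ} 1≤T 3≤Δ = ≤-by (difference T Δ)
  (0≤ℕ 83
   ⊕ u ⊗ (0≤ℕ 175 ⊕ 0≤ℕ 128 ⊗ v ⊕ 0≤ℕ 20 ⊗ (v ⊗ v)
          ⊕ u ⊗ (0≤ℕ 99 ⊕ 0≤ℕ 64 ⊗ v ⊕ 0≤ℕ 8 ⊗ (v ⊗ v) ⊕ u ⊗ (0≤ℕ 13 ⊕ 0≤ℕ 6 ⊗ v)))
   ⊕ v ⊗ (0≤ℕ 68 ⊕ 0≤ℕ 12 ⊗ v))
  where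
  u : 0 ≤ T - 1
  u = p≤q⇒0≤q-p 1≤T
  v : 0 ≤ Δ - 3
  v = p≤q⇒0≤q-p 3≤Δ
  difference : ∀ T Δ → let u = T - 1 ; v = Δ - 3 in
    T * (1 + 2 * T) * ((T + 2 * Δ) * (T + 2 * Δ)) - 2 * (T + Δ) * ((T + 1) * (T + 1) * (T + 1))
    ≡ 83 + u * (175 + 128 * v + 20 * (v * v) + u * (99 + 64 * v + 8 * (v * v) + u * (13 + 6 * v))) + v * (68 + 12 * v)
  difference T Δ = solve (T ∷ Δ ∷ []) ℚ-ring

T[1+2T][T-Δ]m≤2[T+1]³[m-1] : ∀ {T Δ m} → 0 ≤ T → 1 ≤ m → T + 1 ≤ Δ * m →
  T * (1 + 2 * T) * ((T - Δ) * m) ≤ 2 * ((T + 1) * (T + 1) * (T + 1)) * (m - 1)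
T[1+2T][T-Δ]m≤2[T+1]³[m-1] {T} {Δ} {m} 0≤T 1≤m T+1≤Δm = ≤-by (difference T Δ m)
  ((0≤T ⊕ 0≤ℕ 1) ⊗ (0≤ℕ 3 ⊗ 0≤T ⊕ 0≤ℕ 2) ⊗ p≤q⇒0≤q-p 1≤m
   ⊕ 0≤T ⊗ (0≤ℕ 1 ⊕ 0≤ℕ 2 ⊗ 0≤T) ⊗ (p≤q⇒0≤q-p 1≤m ⊕ p≤q⇒0≤q-p T+1≤Δm ⊕ 0≤ℕ 1))
  where
  difference : ∀ T Δ m →
    2 * ((T + 1) * (T + 1) * (T + 1)) * (m - 1) - T * (1 + 2 * T) * ((T - Δ) * m)
    ≡ (T + 1) * (3 * T + 2) * (m - 1) + T * (1 + 2 * T) * ((m - 1) + (Δ * m - (T + 1)) + 1)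
  difference T Δ m = solve (T ∷ Δ ∷ m ∷ []) ℚ-ring

ratio-den : ℚ → ℚ → ℚ
ratio-den N T = (T + 1) * (T + 1) * (T + 1) * ((N - 2 * T) * (N - (2 * T + 1)))

ratio-num : ℚ → ℚ → ℚ → ℚ
ratio-num N K T = 2 * (1 + 2 * T) * ((K - T) * (K - T)) * ((N - K - T) * (N - K - T))

0<ratio-den : ∀ {N K T} → 0 ≤ T → T + 1 ≤ K → 2 * K ≤ N → 0 < ratio-den N T
0<ratio-den {N} {K} {T} 0≤T T+1≤K 2K≤N =
  0<T+1 ⊗⁺ 0<T+1 ⊗⁺ 0<T+1 ⊗⁺ (0<-by (N-2T N K T) (0<ℕ 2 ⊕⁺ slack) ⊗⁺ 0<-by (N-[2T+1] N K T) (0<ℕ 1 ⊕⁺ slack))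
  where
  0<T+1 : 0 < T + 1
  0<T+1 = ℚP.+-mono-≤-< 0≤T (0<ℕ 1)
  slack : 0 ≤ (N - 2 * K) + 2 * (K - (T + 1))
  slack = p≤q⇒0≤q-p 2K≤N ⊕ 0≤ℕ 2 ⊗ p≤q⇒0≤q-p T+1≤K
  N-2T : ∀ N K T → N - 2 * T ≡ 2 + ((N - 2 * K) + 2 * (K - (T + 1)))
  N-2T N K T = solve (N ∷ K ∷ T ∷ []) ℚ-ring
  N-[2T+1] : ∀ N K T → N - (2 * T + 1) ≡ 1 + ((N - 2 * K) + 2 * (K - (T + 1)))
  N-[2T+1] N K T = solve (N ∷ K ∷ T ∷ []) ℚ-ring

ratio-lower-bound : ∀ {N K T Δ} → 1 ≤ T → 3 ≤ Δ → 4 * (T + Δ) ≤ N → 0 ≤ balance N K (T + Δ) →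
  (T + Δ) * ratio-den N T ≤ T * ratio-num N K T
ratio-lower-bound {N} {K} {T} {Δ} 1≤T 3≤Δ 4X≤N 0≤balance = ≤-by-multiple (0<ℕ 2) (certificate N K T Δ)
  (0≤T ⊗ (0≤ℕ 1 ⊕ 0≤ℕ 2 ⊗ 0≤T) ⊗ p≤q⇒0≤q-p (p≤q⇒p*p≤q*q 0≤B B≤A)
   ⊕ 0≤p*p (N - 2 * T) ⊗ p≤q⇒0≤q-p (2[T+Δ][T+1]³≤T[1+2T][T+2Δ]² 1≤T 3≤Δ)
   ⊕ 0≤ℕ 2 ⊗ (0≤T ⊕ 0≤Δ) ⊗ ((0≤T ⊕ 0≤ℕ 1) ⊗ (0≤T ⊕ 0≤ℕ 1) ⊗ (0≤T ⊕ 0≤ℕ 1)) ⊗ 0≤N-2T)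
  where
  A B : ℚ
  A = 2 * ((K - T) * (N - K - T))
  B = (T + 2 * Δ) * (N - 2 * T)
  0≤T : 0 ≤ T
  0≤T = ℚP.≤-trans (0≤ℕ 1) 1≤T
  0≤Δ : 0 ≤ Δ
  0≤Δ = ℚP.≤-trans (0≤ℕ 3) 3≤Δ
  0≤N-2T : 0 ≤ N - 2 * T
  0≤N-2T = 0≤-by (expand N T Δ) (p≤q⇒0≤q-p 4X≤N ⊕ 0≤ℕ 2 ⊗ 0≤T ⊕ 0≤ℕ 4 ⊗ 0≤Δ)
    where
    expand : ∀ N T Δ → N - 2 * T ≡ (N - 4 * (T + Δ)) + 2 * T + 4 * Δ
    expand N T Δ = solve (N ∷ T ∷ Δ ∷ []) ℚ-ring
  0≤B : 0 ≤ B
  0≤B = (0≤T ⊕ 0≤ℕ 2 ⊗ 0≤Δ) ⊗ 0≤N-2T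
  B≤A : B ≤ A
  B≤A = ≤-by (A-B N K T Δ) (0≤balance ⊕ 0≤Δ ⊗ p≤q⇒0≤q-p 4X≤N)
    where
    A-B : ∀ N K T Δ → 2 * ((K - T) * (N - K - T)) - (T + 2 * Δ) * (N - 2 * T)
      ≡ (2 * (K - (T + Δ)) * (N - K - (T + Δ)) - (T + Δ) * (N - 2 * (T + Δ))) + Δ * (N - 4 * (T + Δ))
    A-B N K T Δ = solve (N ∷ K ∷ T ∷ Δ ∷ []) ℚ-ring
  certificate : ∀ N K T Δ →
    2 * (T * (2 * (1 + 2 * T) * ((K - T) * (K - T)) * ((N - K - T) * (N - K - T)))
         - (T + Δ) * ((T + 1) * (T + 1) * (T + 1) * ((N - 2 * T) * (N - (2 * T + 1)))))
    ≡ T * (1 + 2 * T) * (2 * ((K - T) * (N - K - T)) * (2 * ((K - T) * (N - K - T)))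
                         - (T + 2 * Δ) * (N - 2 * T) * ((T + 2 * Δ) * (N - 2 * T)))
      + (N - 2 * T) * (N - 2 * T) * (T * (1 + 2 * T) * ((T + 2 * Δ) * (T + 2 * Δ))
                                     - 2 * (T + Δ) * ((T + 1) * (T + 1) * (T + 1)))
      + 2 * (T + Δ) * ((T + 1) * (T + 1) * (T + 1)) * (N - 2 * T)
  certificate N K T Δ = solve (N ∷ K ∷ T ∷ Δ ∷ []) ℚ-ring

ratio-upper-bound : ∀ {N K T Δ} → 0 ≤ T → T + 1 ≤ K → 2 * K ≤ N → 0 ≤ Δ → 2 * N ≤ Δ * (N - 2 * K) →
  0 < T - Δ → balance N K (T - Δ) ≤ 0 → T * ratio-num N K T ≤ (T - Δ) * ratio-den N T
ratio-upper-bound {N} {K} {T} {Δ} 0≤T T+1≤K 2K≤N 0≤Δ 2N≤Δ[N-2K] 0<X balance≤0 =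
  ≤-by-multiple (0<ℕ 2) (certificate N K T Δ)
    (0≤T ⊗ (0≤ℕ 1 ⊕ 0≤ℕ 2 ⊗ 0≤T) ⊗ p≤q⇒0≤q-p (p≤q⇒p*p≤q*q 0≤A A≤Xm)
     ⊕ ℚP.<⇒≤ 0<X ⊗ (ℚP.≤-trans (0≤ℕ 1) 1≤m) ⊗ p≤q⇒0≤q-p (T[1+2T][T-Δ]m≤2[T+1]³[m-1] 0≤T 1≤m T+1≤Δm))
  where
  0≤N-2K : 0 ≤ N - 2 * K
  0≤N-2K = p≤q⇒0≤q-p 2K≤N
  0≤K-[T+1] : 0 ≤ K - (T + 1)
  0≤K-[T+1] = p≤q⇒0≤q-p T+1≤K
  0≤K-T : 0 ≤ K - T
  0≤K-T = 0≤-by (expand K T) (0≤K-[T+1] ⊕ 0≤ℕ 1)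
    where
    expand : ∀ K T → K - T ≡ K - (T + 1) + 1
    expand K T = solve (K ∷ T ∷ []) ℚ-ring
  1≤m : 1 ≤ N - 2 * T
  1≤m = ≤-by (expand N K T) (0≤N-2K ⊕ 0≤ℕ 2 ⊗ 0≤K-[T+1] ⊕ 0≤ℕ 1)
    where
    expand : ∀ N K T → N - 2 * T - 1 ≡ (N - 2 * K) + 2 * (K - (T + 1)) + 1
    expand N K T = solve (N ∷ K ∷ T ∷ []) ℚ-ring
  T+1≤Δm : T + 1 ≤ Δ * (N - 2 * T)
  T+1≤Δm = ≤-by (expand N K T Δ)
    (p≤q⇒0≤q-p 2N≤Δ[N-2K] ⊕ 0≤ℕ 2 ⊗ 0≤Δ ⊗ 0≤K-T ⊕ 0≤ℕ 2 ⊗ 0≤N-2K ⊕ 0≤ℕ 4 ⊗ 0≤K-[T+1]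
     ⊕ 0≤ℕ 3 ⊗ 0≤T ⊕ 0≤ℕ 3)
    where
    expand : ∀ N K T Δ → Δ * (N - 2 * T) - (T + 1)
      ≡ (Δ * (N - 2 * K) - 2 * N) + 2 * Δ * (K - T) + 2 * (N - 2 * K) + 4 * (K - (T + 1)) + 3 * T + 3
    expand N K T Δ = solve (N ∷ K ∷ T ∷ Δ ∷ []) ℚ-ring
  A : ℚ
  A = 2 * ((K - T) * (N - K - T))
  0≤A : 0 ≤ A
  0≤A = 0≤ℕ 2 ⊗ (0≤K-T ⊗ 0≤-by (expand N K T) (0≤N-2K ⊕ 0≤K-T))
    where
    expand : ∀ N K T → N - K - T ≡ (N - 2 * K) + (K - T)
    expand N K T = solve (N ∷ K ∷ T ∷ []) ℚ-ring
  A≤Xm : A ≤ (T - Δ) * (N - 2 * T)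
  A≤Xm = ≤-by refl (0≤-by-multiple 0<K-X (expand N K T Δ)
    (0≤K-T ⊗ p≤q⇒0≤q-p balance≤0 ⊕ 0≤Δ ⊗ ℚP.<⇒≤ 0<X ⊗ 0≤N-2K
     ⊕ 0≤ℕ 2 ⊗ 0≤Δ ⊗ 0≤K-T ⊗ ℚP.<⇒≤ 0<K-X))
    where
    0<K-X : 0 < K - (T - Δ)
    0<K-X = 0<-by (expand′ K T Δ) (0<ℕ 1 ⊕⁺ 0≤K-[T+1] ⊕⁺ 0≤Δ)
      where
      expand′ : ∀ K T Δ → K - (T - Δ) ≡ 1 + (K - (T + 1)) + Δ
      expand′ K T Δ = solve (K ∷ T ∷ Δ ∷ []) ℚ-ring
    expand : ∀ N K T Δ → (K - (T - Δ)) * ((T - Δ) * (N - 2 * T) - 2 * ((K - T) * (N - K - T)))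
      ≡ (K - T) * (0 - (2 * (K - (T - Δ)) * (N - K - (T - Δ)) - (T - Δ) * (N - 2 * (T - Δ))))
        + Δ * (T - Δ) * (N - 2 * K) + 2 * Δ * (K - T) * (K - (T - Δ))
    expand N K T Δ = solve (N ∷ K ∷ T ∷ Δ ∷ []) ℚ-ring
  certificate : ∀ N K T Δ →
    2 * ((T - Δ) * ((T + 1) * (T + 1) * (T + 1) * ((N - 2 * T) * (N - (2 * T + 1))))
         - T * (2 * (1 + 2 * T) * ((K - T) * (K - T)) * ((N - K - T) * (N - K - T))))
    ≡ T * (1 + 2 * T) * ((T - Δ) * (N - 2 * T) * ((T - Δ) * (N - 2 * T))
                         - 2 * ((K - T) * (N - K - T)) * (2 * ((K - T) * (N - K - T))))
      + (T - Δ) * (N - 2 * T) * (2 * ((T + 1) * (T + 1) * (T + 1)) * (N - 2 * T - 1)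
                                 - T * (1 + 2 * T) * ((T - Δ) * (N - 2 * T)))
  certificate N K T Δ = solve (N ∷ K ∷ T ∷ Δ ∷ []) ℚ-ring

T*W*R≡T*V : ∀ {R W V} T → R * W ≡ V → T * W * R ≡ T * V
T*W*R≡T*V {R} {W} T RW≡V = trans (reorder T W R) (cong (T *_) RW≡V)
  where
  reorder : ∀ T W R → T * W * R ≡ T * (R * W)
  reorder T W R = solve (T ∷ W ∷ R ∷ []) ℚ-ring

1+Δ/T≤R : ∀ {R T Δ W V} → 0 < T → 0 < W → R * W ≡ V → (T + Δ) * W ≤ T * V → 1ℚ + Δ /? T ≤ R
1+Δ/T≤R {R} {T} {Δ} {W} {V} 0<T 0<W RW≡V [T+Δ]W≤TV =
  ℚP.*-cancelˡ-≤-pos (T * W) {{ℚ.positive (0<T ⊗⁺ 0<W)}}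
    (subst₂ _≤_ (sym TW[1+Δ/T]≡[T+Δ]W) (sym (T*W*R≡T*V T RW≡V)) [T+Δ]W≤TV)
  where
  open ≡-Reasoning
  TW[1+Δ/T]≡[T+Δ]W : T * W * (1ℚ + Δ /? T) ≡ (T + Δ) * W
  TW[1+Δ/T]≡[T+Δ]W = begin
    T * W * (1ℚ + Δ /? T)       ≡⟨ expand T W (Δ /? T) ⟩
    T * W + (Δ /? T * T) * W    ≡⟨ cong (λ x → T * W + x * W) (p/?q*q≡p Δ (0<q⇒q≢0 0<T)) ⟩
    T * W + Δ * W               ≡⟨ ℚP.*-distribʳ-+ W T Δ ⟨
    (T + Δ) * W                 ∎
    where
    expand : ∀ T W y → T * W * (1ℚ + y) ≡ T * W + (y * T) * W
    expand T W y = solve (T ∷ W ∷ y ∷ []) ℚ-ring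

R≤1-Δ/T : ∀ {R T Δ W V} → 0 < T → 0 < W → R * W ≡ V → T * V ≤ (T - Δ) * W → R ≤ 1ℚ - Δ /? T
R≤1-Δ/T {R} {T} {Δ} {W} {V} 0<T 0<W RW≡V TV≤[T-Δ]W =
  ℚP.*-cancelˡ-≤-pos (T * W) {{ℚ.positive (0<T ⊗⁺ 0<W)}}
    (subst₂ _≤_ (sym (T*W*R≡T*V T RW≡V)) (sym TW[1-Δ/T]≡[T-Δ]W) TV≤[T-Δ]W)
  where
  open ≡-Reasoning
  TW[1-Δ/T]≡[T-Δ]W : T * W * (1ℚ - Δ /? T) ≡ (T - Δ) * W
  TW[1-Δ/T]≡[T-Δ]W = begin
    T * W * (1ℚ - Δ /? T)       ≡⟨ expand T W (Δ /? T) ⟩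
    T * W - (Δ /? T * T) * W    ≡⟨ cong (λ x → T * W - x * W) (p/?q*q≡p Δ (0<q⇒q≢0 0<T)) ⟩
    T * W - Δ * W               ≡⟨ factor T W Δ ⟩
    (T - Δ) * W                 ∎
    where
    expand : ∀ T W y → T * W * (1ℚ - y) ≡ T * W - (y * T) * W
    expand T W y = solve (T ∷ W ∷ y ∷ []) ℚ-ring
    factor : ∀ T W Δ → T * W - Δ * W ≡ (T - Δ) * W
    factor T W Δ = solve (T ∷ W ∷ Δ ∷ []) ℚ-ring

quotient-ratio : ∀ {a b q w v} → 0 < a → 0 < q → b * w ≡ a * v → ((b /? q) /? (a /? q)) * w ≡ v
quotient-ratio {a} {b} {q} {w} {v} 0<a 0<q bw≡av = *-cancelˡ-≡-pos 0<a (begin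
  a * (R * w)                  ≡⟨ cong (_* (R * w)) xq≡a ⟨
  x * q * (R * w)              ≡⟨ reorder x q R w ⟩
  R * x * q * w                ≡⟨ cong (λ y → y * q * w) (p/?q*q≡p (b /? q) x≢0) ⟩
  (b /? q) * q * w             ≡⟨ cong (_* w) (p/?q*q≡p b (0<q⇒q≢0 0<q)) ⟩
  b * w                        ≡⟨ bw≡av ⟩
  a * v                        ∎)
  where
  open ≡-Reasoning
  x R : ℚ
  x = a /? q
  R = (b /? q) /? x
  xq≡a : x * q ≡ a
  xq≡a = p/?q*q≡p a (0<q⇒q≢0 0<q)
  x≢0 : ¬ x ≡ 0
  x≢0 x≡0 = 0<q⇒q≢0 0<a (trans (sym xq≡a) (trans (cong (_* q) x≡0) (ℚP.*-zeroˡ q)))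
  reorder : ∀ x q R w → x * q * (R * w) ≡ R * x * q * w
  reorder x q R w = solve (x ∷ q ∷ R ∷ w ∷ []) ℚ-ring

s-ratio : ∀ {n k t} → suc t ℕ.≤ k → 2 ℕ.* k ℕ.≤ n →
  (s n k (suc t) /? s n k t) * ratio-den (ℕ→ℚ n) (ℕ→ℚ t) ≡ ratio-num (ℕ→ℚ n) (ℕ→ℚ k) (ℕ→ℚ t)
s-ratio {n} {k} {t} t<k 2k≤n = quotient-ratio
  (ℕ→ℚ-mono-< {0} (0<s-numerator (ℕP.<⇒≤ t<k) 2k≤n))
  (ℕ→ℚ-mono-< {0} (ℕP.m^n>0 (n C k) {{ℕ.>-nonZero (0<nCk (ℕP.≤-trans (ℕP.m≤m+n k (k ℕ.+ 0)) 2k≤n))}} 2))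
  (trans (sym (ℕ→ℚ-*₂ (s-numerator n k (suc t)) Wn refl Wn≡ratio-den))
         (trans (cong ℕ→ℚ (s-numerator-ratio t<k 2k≤n)) (ℕ→ℚ-*₂ (s-numerator n k t) Vn refl Vn≡ratio-num)))
  where
  N K T : ℚ
  N = ℕ→ℚ n
  K = ℕ→ℚ k
  T = ℕ→ℚ t
  m j l : ℕ
  m = n ℕ.∸ 2 ℕ.* t
  j = k ℕ.∸ t
  l = m ℕ.∸ j
  Wn Vn : ℕ
  Wn = suc t ℕ.* suc t ℕ.* suc t ℕ.* (m ℕ.* (n ℕ.∸ suc (2 ℕ.* t)))
  Vn = 2 ℕ.* (1 ℕ.+ 2 ℕ.* t) ℕ.* (j ℕ.* j) ℕ.* (l ℕ.* l)
  2t<n : 2 ℕ.* t ℕ.< n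
  2t<n = ℕP.<-≤-trans (ℕP.*-monoʳ-< 2 t<k) 2k≤n
  T+1 : ℕ→ℚ (suc t) ≡ T + 1
  T+1 = ℕ→ℚ-suc t
  N-2T : ℕ→ℚ m ≡ N - 2 * T
  N-2T = trans (ℕ→ℚ-∸ (ℕP.<⇒≤ 2t<n)) (cong (N -_) (ℕ→ℚ-* 2 t))
  N-[2T+1] : ℕ→ℚ (n ℕ.∸ suc (2 ℕ.* t)) ≡ N - (2 * T + 1)
  N-[2T+1] = trans (ℕ→ℚ-∸ 2t<n) (cong (N -_) (trans (ℕ→ℚ-suc (2 ℕ.* t)) (cong (_+ 1) (ℕ→ℚ-* 2 t))))
  K-T : ℕ→ℚ j ≡ K - T
  K-T = ℕ→ℚ-∸ (ℕP.<⇒≤ t<k)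
  N-K-T : ℕ→ℚ l ≡ N - K - T
  N-K-T = trans (ℕ→ℚ-∸ (k∸t≤n∸2t t 2k≤n)) (trans (cong₂ _-_ N-2T K-T) (regroup N K T))
    where
    regroup : ∀ N K T → N - 2 * T - (K - T) ≡ N - K - T
    regroup N K T = solve (N ∷ K ∷ T ∷ []) ℚ-ring
  Wn≡ratio-den : ℕ→ℚ Wn ≡ ratio-den N T
  Wn≡ratio-den = ℕ→ℚ-*₂ (suc t ℕ.* suc t ℕ.* suc t) (m ℕ.* (n ℕ.∸ suc (2 ℕ.* t)))
             (ℕ→ℚ-*₂ (suc t ℕ.* suc t) (suc t) (ℕ→ℚ-*₂ (suc t) (suc t) T+1 T+1) T+1)
             (ℕ→ℚ-*₂ m (n ℕ.∸ suc (2 ℕ.* t)) N-2T N-[2T+1])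
  Vn≡ratio-num : ℕ→ℚ Vn ≡ ratio-num N K T
  Vn≡ratio-num = ℕ→ℚ-*₂ (2 ℕ.* (1 ℕ.+ 2 ℕ.* t) ℕ.* (j ℕ.* j)) (l ℕ.* l)
             (ℕ→ℚ-*₂ (2 ℕ.* (1 ℕ.+ 2 ℕ.* t)) (j ℕ.* j)
               (ℕ→ℚ-*₂ 2 (1 ℕ.+ 2 ℕ.* t) refl (trans (ℕ→ℚ-+ 1 (2 ℕ.* t)) (cong (_+_ 1) (ℕ→ℚ-* 2 t))))
               (ℕ→ℚ-*₂ j j K-T K-T))
             (ℕ→ℚ-*₂ l l N-K-T N-K-T)

exponent-comparison : ∀ {a d p m e} → a ℕ.^ d ℕ.≤ 2 ℕ.^ p → 2 ℕ.^ m ℕ.≤ a ℕ.^ e → m ℕ.* d ℕ.≤ p ℕ.* e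
exponent-comparison {a} {d} {p} {m} {e} a^d≤2^p 2^m≤a^e =
  ℕP.≮⇒≥ (λ pe<md → ℕP.<⇒≱ (ℕP.^-monoʳ-< 2 (s≤s (s≤s z≤n)) pe<md) 2^md≤2^pe)
  where
  open ℕP.≤-Reasoning
  2^md≤2^pe : 2 ℕ.^ (m ℕ.* d) ℕ.≤ 2 ℕ.^ (p ℕ.* e)
  2^md≤2^pe = begin
    2 ℕ.^ (m ℕ.* d)    ≡⟨ ℕP.^-*-assoc 2 m d ⟨
    (2 ℕ.^ m) ℕ.^ d    ≤⟨ ℕP.^-monoˡ-≤ d 2^m≤a^e ⟩
    (a ℕ.^ e) ℕ.^ d    ≡⟨ ℕP.^-*-assoc a e d ⟩
    a ℕ.^ (e ℕ.* d)    ≡⟨ cong (a ℕ.^_) (ℕP.*-comm e d) ⟩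
    a ℕ.^ (d ℕ.* e)    ≡⟨ ℕP.^-*-assoc a d e ⟨
    (a ℕ.^ d) ℕ.^ e    ≤⟨ ℕP.^-monoˡ-≤ e a^d≤2^p ⟩
    (2 ℕ.^ p) ℕ.^ e    ≡⟨ ℕP.^-*-assoc 2 p e ⟩
    2 ℕ.^ (p ℕ.* e)    ∎

p*↧p≡↥p : ∀ p → p * ℕ→ℚ (ℚ.↧ₙ p) ≡ ℤ→ℚ (ℚ.↥ p)
p*↧p≡↥p p@record{} = begin
  p * ℕ→ℚ (ℚ.↧ₙ p)        ≡⟨ cong (p *_) (ℤ→ℚ≡fromℤ (+ ℚ.↧ₙ p)) ⟩
  p * fromℤ (+ ℚ.↧ₙ p)    ≡⟨ ℚP.toℚᵘ-injective (ℚᵘP.≃-trans (ℚP.toℚᵘ-homo-* p (fromℤ (+ ℚ.↧ₙ p)))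
                                                          (ℚᵘ.*≡* (ℤP.*-assoc (ℚ.↥ p) (+ ℚ.↧ₙ p) (+ 1)))) ⟩
  fromℤ (ℚ.↥ p)            ≡⟨ ℤ→ℚ≡fromℤ (ℚ.↥ p) ⟨
  ℤ→ℚ (ℚ.↥ p)              ∎
  where open ≡-Reasoning

log₂≤⇒2N≤Δ[N-2K] : ∀ n k Δ → log₂ n ≤ Δ → UpperK n k →
  0 ≤ Δ × 2 * ℕ→ℚ n ≤ Δ * (ℕ→ℚ n - 2 * ℕ→ℚ k)
log₂≤⇒2N≤Δ[N-2K] n k Δ (0≤↥Δ , n^d≤2^p) (2k≤n , 2^2n≤n^e) = 0≤Δ , 2N≤Δ[N-2K]
  where
  N K : ℚ
  N = ℕ→ℚ n
  K = ℕ→ℚ k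
  d p : ℕ
  d = ℚ.↧ₙ Δ
  p = ℤ.∣ ℚ.↥ Δ ∣
  0<d : 0 < ℕ→ℚ d
  0<d = 0<ℕ d
  Δd≡p : Δ * ℕ→ℚ d ≡ ℕ→ℚ p
  Δd≡p = trans (p*↧p≡↥p Δ) (cong ℤ→ℚ (sym (ℤP.0≤i⇒+∣i∣≡i 0≤↥Δ)))
  0≤Δ : 0 ≤ Δ
  0≤Δ = ℚP.*-cancelʳ-≤-pos (ℕ→ℚ d) {{ℚ.positive 0<d}}
          (subst₂ _≤_ (sym (ℚP.*-zeroˡ (ℕ→ℚ d))) (sym Δd≡p) (0≤ℕ p))
  2N≤Δ[N-2K] : 2 * N ≤ Δ * (N - 2 * K)
  2N≤Δ[N-2K] = ℚP.*-cancelʳ-≤-pos (ℕ→ℚ d) {{ℚ.positive 0<d}} (begin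
    2 * N * ℕ→ℚ d              ≡⟨ ℕ→ℚ-*₂ (2 ℕ.* n) d (ℕ→ℚ-* 2 n) refl ⟨
    ℕ→ℚ (2 ℕ.* n ℕ.* d)
      ≤⟨ ℕ→ℚ-mono-≤ (exponent-comparison {n} {d} {p} {2 ℕ.* n} {n ℕ.∸ 2 ℕ.* k} n^d≤2^p 2^2n≤n^e) ⟩
    ℕ→ℚ (p ℕ.* (n ℕ.∸ 2 ℕ.* k))
      ≡⟨ ℕ→ℚ-*₂ p (n ℕ.∸ 2 ℕ.* k) refl (trans (ℕ→ℚ-∸ 2k≤n) (cong (N -_) (ℕ→ℚ-* 2 k))) ⟩
    ℕ→ℚ p * (N - 2 * K)        ≡⟨ cong (_* (N - 2 * K)) Δd≡p ⟨
    Δ * ℕ→ℚ d * (N - 2 * K)    ≡⟨ reorder Δ (ℕ→ℚ d) (N - 2 * K) ⟩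
    Δ * (N - 2 * K) * ℕ→ℚ d    ∎)
    where
    open ℚP.≤-Reasoning
    reorder : ∀ x y z → x * y * z ≡ x * z * y
    reorder x y z = solve (x ∷ y ∷ z ∷ []) ℚ-ring

LowerK⇒1≤k : ∀ n k → 1 ℕ.≤ n → LowerK n k → 1 ℕ.≤ k
LowerK⇒1≤k n zero    1≤n 2^n≤1 = ⊥-elim (ℕP.<⇒≱ (ℕP.^-monoʳ-< 2 (s≤s (s≤s z≤n)) 1≤n) 2^n≤1)
LowerK⇒1≤k n (suc _) _   _     = s≤s z≤n

UpperK⇒2k<n : ∀ n k → 1 ℕ.≤ n → UpperK n k → 2 ℕ.* k ℕ.< n
UpperK⇒2k<n n k 1≤n (2k≤n , 2^2n≤n^[n-2k]) with ℕP.m≤n⇒m<n∨m≡n 2k≤n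
... | inj₁ 2k<n = 2k<n
... | inj₂ 2k≡n = ⊥-elim (ℕP.<⇒≱ (ℕP.^-monoʳ-< 2 (s≤s (s≤s z≤n)) (ℕP.≤-trans 1≤n (ℕP.m≤m+n n (n ℕ.+ 0))))
                               (subst (λ e → 2 ℕ.^ (2 ℕ.* n) ℕ.≤ n ℕ.^ e) n∸2k≡0 2^2n≤n^[n-2k]))
  where
  n∸2k≡0 : n ℕ.∸ 2 ℕ.* k ≡ 0
  n∸2k≡0 = trans (cong (n ℕ.∸_) 2k≡n) (ℕP.n∸n≡0 n)

0≤balance[K/3] : ∀ {N K q} → 0 ≤ K → 2 * K ≤ N → q * 3 ≡ K → 4 * q ≤ N × 0 ≤ balance N K q
0≤balance[K/3] {N} {q = q} 0≤K 2K≤N refl =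
  ≤-by (expand₁ N q) (p≤q⇒0≤q-p 2K≤N ⊕ 0≤ℕ 2 ⊗ 0≤q) ,
  0≤-by (expand₂ N q) (0≤q ⊗ (0≤ℕ 3 ⊗ p≤q⇒0≤q-p 2K≤N ⊕ 0≤ℕ 4 ⊗ 0≤q))
  where
  0≤q : 0 ≤ q
  0≤q = 0≤-by-multiple (0<ℕ 3) (ℚP.*-comm 3 q) 0≤K
  expand₁ : ∀ N q → N - 4 * q ≡ (N - 2 * (q * 3)) + 2 * q
  expand₁ N q = solve (N ∷ q ∷ []) ℚ-ring
  expand₂ : ∀ N q → 2 * (q * 3 - q) * (N - q * 3 - q) - q * (N - 2 * q) ≡ q * (3 * (N - 2 * (q * 3)) + 4 * q)
  expand₂ N q = solve (N ∷ q ∷ []) ℚ-ring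

balance[11K/12]≤0 : ∀ {N K q} → 0 ≤ K → 2 * K ≤ N → q * 12 ≡ 11 * K → balance N K q ≤ 0
balance[11K/12]≤0 {N} {K} {q} 0≤K 2K≤N 12q≡11K =
  ≤-by-multiple (0<ℕ 36) certificate (0≤K ⊗ (0≤ℕ 27 ⊗ p≤q⇒0≤q-p 2K≤N ⊕ 0≤ℕ 5 ⊗ 0≤K))
  where
  open ≡-Reasoning
  expand : ∀ N K q → 36 * (0 - (2 * (K - q) * (N - K - q) - q * (N - 2 * q)))
    ≡ K * (27 * (N - 2 * K) + 5 * K) + (q * 12 - 11 * K) * (9 * N - 12 * q - 11 * K)
  expand N K q = solve (N ∷ K ∷ q ∷ []) ℚ-ring
  certificate : 36 * (0 - balance N K q) ≡ K * (27 * (N - 2 * K) + 5 * K)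
  certificate = begin
    36 * (0 - balance N K q)                                                       ≡⟨ expand N K q ⟩
    K * (27 * (N - 2 * K) + 5 * K) + (q * 12 - 11 * K) * (9 * N - 12 * q - 11 * K)
      ≡⟨ cong (λ x → K * (27 * (N - 2 * K) + 5 * K) + x * (9 * N - 12 * q - 11 * K))
              (trans (cong (_- 11 * K) 12q≡11K) (ℚP.+-inverseʳ (11 * K))) ⟩
    K * (27 * (N - 2 * K) + 5 * K) + 0 * (9 * N - 12 * q - 11 * K)
      ≡⟨ cong (_+_ (K * (27 * (N - 2 * K) + 5 * K))) (ℚP.*-zeroˡ (9 * N - 12 * q - 11 * K)) ⟩
    K * (27 * (N - 2 * K) + 5 * K) + 0                                             ≡⟨ ℚP.+-identityʳ _ ⟩
    K * (27 * (N - 2 * K) + 5 * K)                                                 ∎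

t₁-bounds : ∀ n k → 2 ℕ.* k ℕ.≤ n →
  (ℕ→ℚ k /? ℕ→ℚ 3) ≤t₁[ n , k ] × t₁[ n , k ]≤ (ℕ→ℚ (11 ℕ.* k) /? ℕ→ℚ 12)
t₁-bounds n k 2k≤n =
  uncurry (0≤balance⇒≤t₁ n k (ℕ→ℚ k /? ℕ→ℚ 3))
          (0≤balance[K/3] (0≤ℕ k) (2k≤n⇒2K≤N n k 2k≤n) (p/?q*q≡p (ℕ→ℚ k) (0<q⇒q≢0 (0<ℕ 3)))) ,
  balance≤0⇒t₁≤ n k (ℕ→ℚ (11 ℕ.* k) /? ℕ→ℚ 12) (balance[11K/12]≤0 (0≤ℕ k) (2k≤n⇒2K≤N n k 2k≤n)
                   (trans (p/?q*q≡p (ℕ→ℚ (11 ℕ.* k)) (0<q⇒q≢0 (0<ℕ 12))) (ℕ→ℚ-* 11 k)))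

s-ratio-lower-bound : ∀ {n k} → 1 ℕ.≤ k → 2 ℕ.* k ℕ.< n → ∀ {Δ} → ℕ→ℚ 3 ≤ Δ → ∀ t → 1 ℕ.≤ t →
  (ℕ→ℚ t + Δ) ≤t₁[ n , k ] → 1ℚ + (Δ /? ℕ→ℚ t) ≤ (s n k (suc t) /? s n k t)
s-ratio-lower-bound {n} {k} 1≤k 2k<n {Δ} 3≤Δ t 1≤t T+Δ≤t₁ =
  1+Δ/T≤R (ℚP.<-≤-trans (0<ℕ 1) 1≤T) (0<ratio-den (0≤ℕ t) (ℚP.<⇒≤ T+1<K) (ℚP.<⇒≤ 2K<N))
    (s-ratio {n} {k} {t} t<k (ℕP.<⇒≤ 2k<n))
    (ratio-lower-bound 1≤T 3≤Δ 4[T+Δ]≤N 0≤balance)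
  where
  K T : ℚ
  K = ℕ→ℚ k
  T = ℕ→ℚ t
  4[T+Δ]≤N : 4 * (T + Δ) ≤ ℕ→ℚ n
  4[T+Δ]≤N = ≤t₁⇒4X≤N n k (T + Δ) T+Δ≤t₁
  0≤balance : 0 ≤ balance (ℕ→ℚ n) K (T + Δ)
  0≤balance = ≤t₁⇒0≤balance n k (T + Δ) T+Δ≤t₁
  1≤T : 1 ≤ T
  1≤T = ℕ→ℚ-mono-≤ 1≤t
  2K<N : 2 * K < ℕ→ℚ n
  2K<N = subst (_< ℕ→ℚ n) (ℕ→ℚ-* 2 k) (ℕ→ℚ-mono-< 2k<n)
  T+Δ<K : T + Δ < K
  T+Δ<K = 0≤balance⇒<K (ℚP.<-≤-trans (0<ℕ 1) (ℕ→ℚ-mono-≤ 1≤k)) 2K<N 4[T+Δ]≤N 0≤balance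
  T+1<K : T + 1 < K
  T+1<K = ℚP.≤-<-trans (ℚP.+-monoʳ-≤ T (ℚP.≤-trans (ℕ→ℚ-mono-≤ {1} {3} (s≤s z≤n)) 3≤Δ)) T+Δ<K
  t<k : suc t ℕ.≤ k
  t<k = ℕP.<⇒≤ (ℕ→ℚ-cancel-< (subst (_< K) (sym (ℕ→ℚ-suc t)) T+1<K))

s-ratio-upper-bound : ∀ {n k} → UpperK n k → ∀ {Δ} → log₂ n ≤ Δ → ∀ t →
  t₁[ n , k ]≤ (ℕ→ℚ t - Δ) → suc t ℕ.≤ k → (s n k (suc t) /? s n k t) ≤ 1ℚ - (Δ /? ℕ→ℚ t)
s-ratio-upper-bound {n} {k} upper@(2k≤n , _) {Δ} log₂n≤Δ t t₁≤T-Δ t<k =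
  R≤1-Δ/T 0<T (0<ratio-den (0≤ℕ t) T+1≤K (2k≤n⇒2K≤N n k 2k≤n)) (s-ratio {n} {k} {t} t<k 2k≤n)
    (ratio-upper-bound (0≤ℕ t) T+1≤K (2k≤n⇒2K≤N n k 2k≤n) 0≤Δ (proj₂ Δ-bounds) 0<T-Δ balance≤0)
  where
  N K T : ℚ
  N = ℕ→ℚ n
  K = ℕ→ℚ k
  T = ℕ→ℚ t
  Δ-bounds : 0 ≤ Δ × 2 * N ≤ Δ * (N - 2 * K)
  Δ-bounds = log₂≤⇒2N≤Δ[N-2K] n k Δ log₂n≤Δ upper
  0≤Δ : 0 ≤ Δ
  0≤Δ = proj₁ Δ-bounds
  T+1≤K : T + 1 ≤ K
  T+1≤K = subst (_≤ K) (ℕ→ℚ-suc t) (ℕ→ℚ-mono-≤ t<k)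
  2[T-Δ]≤N : 2 * (T - Δ) ≤ N
  2[T-Δ]≤N = ≤-by (expand N K T Δ)
    (p≤q⇒0≤q-p (2k≤n⇒2K≤N n k 2k≤n) ⊕ 0≤ℕ 2 ⊗ p≤q⇒0≤q-p T+1≤K ⊕ 0≤ℕ 2 ⊕ 0≤ℕ 2 ⊗ 0≤Δ)
    where
    expand : ∀ N K T Δ → N - 2 * (T - Δ) ≡ (N - 2 * K) + 2 * (K - (T + 1)) + 2 + 2 * Δ
    expand N K T Δ = solve (N ∷ K ∷ T ∷ Δ ∷ []) ℚ-ring
  balance≤0 : balance N K (T - Δ) ≤ 0
  balance≤0 = t₁≤⇒balance≤0 n k (T - Δ) 2[T-Δ]≤N t₁≤T-Δ
  0<T-Δ : 0 < T - Δ
  0<T-Δ = balance≤0⇒0<X (ℚP.<-≤-trans (ℚP.+-mono-≤-< (0≤ℕ t) (0<ℕ 1)) T+1≤K) (2k≤n⇒2K≤N n k 2k≤n) balance≤0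
  0<T : 0 < T
  0<T = 0<-by (expand T Δ) (0<T-Δ ⊕⁺ 0≤Δ)
    where
    expand : ∀ T Δ → T ≡ T - Δ + Δ
    expand T Δ = solve (T ∷ Δ ∷ []) ℚ-ring

-- The hypotheses Δ < t₁ in (2) and t₁ < k - Δ in (3) only make the ranges of t nonempty.
lemma4p7 : Σ ℕ λ n₀ → (n k : ℕ) → n₀ ℕ.≤ n → LowerK n k → UpperK n k →
    -- (1) k/3 ≤ t₁ ≤ 11k/12
    ((ℕ→ℚ k /? ℕ→ℚ 3) ≤t₁[ n , k ] × t₁[ n , k ]≤ (ℕ→ℚ (11 ℕ.* k) /? ℕ→ℚ 12))
    -- (2) 3 ≤ Δ < t₁, 1 ≤ t ≤ t₁ - Δ  ⇒  s_{t+1}/s_t ≥ 1 + Δ/t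
  × ((Δ : ℚ) → ℕ→ℚ 3 ≤ Δ → Δ <t₁[ n , k ] → (t : ℕ) → 1 ℕ.≤ t →
      (ℕ→ℚ t + Δ) ≤t₁[ n , k ] →
      1ℚ + (Δ /? ℕ→ℚ t) ≤ (s n k (suc t) /? s n k t))
    -- (3) log n ≤ Δ < k - t₁, t₁ + Δ ≤ t ≤ k - 1  ⇒  s_{t+1}/s_t ≤ 1 - Δ/t
  × ((Δ : ℚ) → log₂ n ≤ Δ → t₁[ n , k ]< (ℕ→ℚ k - Δ) → (t : ℕ) →
      t₁[ n , k ]≤ (ℕ→ℚ t - Δ) → suc t ℕ.≤ k →
      (s n k (suc t) /? s n k t) ≤ 1ℚ - (Δ /? ℕ→ℚ t))
lemma4p7 = 1 , λ n k 1≤n lower upper →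
  t₁-bounds n k (proj₁ upper) ,
  (λ Δ 3≤Δ _ → s-ratio-lower-bound (LowerK⇒1≤k n k 1≤n lower) (UpperK⇒2k<n n k 1≤n upper) 3≤Δ) ,
  (λ Δ log₂n≤Δ _ → s-ratio-upper-bound upper log₂n≤Δ)
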